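{- Let $D$ be a diagram with nonempty columns $c_1<c_2<\cdots<c_n$, and for $i\in[n]$ let $(r_i,c_i)$ be the topmost cell in column $c_i$ of $D$. Then \[\mathrm{mc}(D)=\sum_{i=1}^n\bigl[r_i-h(D,c_i)\bigr].\]
   Context: A diagram is a finite subset $D\subset\mathbb{Z}_{>0}\times\mathbb{Z}_{>0}$; an element $(r,c)\in D$ is a cell in row $r$, column $c$. For $r\in\mathbb{Z}_{>0}$, the Kohnert move at row $r$: if row $r$ of $D$ is empty, $\mathcal{K}(D,r)=D$; otherwise let $(r,c)$ be the cell of row $r$ with largest column index; if some $r'<r$ has $(r',c)\notin D$, let $r'$ be the largest such and $\mathcal{K}(D,r)=(D\setminus\{(r,c)\})\cup\{(r',c)\}$; otherwise $\mathcal{K}(D,r)=D$. The move is nontrivial if $\mathcal{K}(D,r)\ne D$. $\mathrm{KD}(D)$ is the set of diagrams obtainable from $D$ by finite (possibly empty) sequences of Kohnert moves; $\mathrm{Min}(D)=\{\tilde D\in\mathrm{KD}(D):\mathcal{K}(\tilde D,r)=\tilde D\ \forall r\}$. $\mathrm{mc}(D)$ is the minimum, over all $\tilde D\in\mathrm{Min}(D)$ and all sequences $(r_1,\dots,r_m)$ such that with $D_0=D$, $D_i=\mathcal{K}(D_{i-1},r_i)$ each move is nontrivial and $D_m=\tilde D$, of the length $m$. For a nonempty column $c$ of $D$: let $m_c$ be the number of cells in column $c$, $M$ the maximum number of cells in a column strictly to the right of $c$ (with $M=0$ if there is none), and $r$ the row of the topmost cell of column $c$; define $h(D,c)=r$ if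 $M\ge r$, $h(D,c)=m_c$ if $m_c\ge M$, and $h(D,c)=M$ if $r>M>m_c$. -}

module Defs where

open import Data.Nat using (ℕ; zero; suc; _+_; _∸_; _≤_; _<_; _⊔_; _≤ᵇ_; _<ᵇ_)
open import Data.Nat.Properties using (_≟_)
open import Data.Bool using (Bool; true; false; if_then_else_)
open import Data.Product using (Σ; ∃; _×_; _,_; proj₁; proj₂)
open import Data.Sum using (_⊎_)
open import Data.List using (List; []; _∷_; length; filter; map; foldr; sum)
open import Data.List.Membership.Propositional using (_∈_; _∉_)
open import Relation.Nullary using (¬_)
open import Relation.Binary.PropositionalEquality using (_≡_; _≢_)
open import Function.Bundles using (_⇔_)

-- A diagram is represented by a list of
-- cells, read as the finite SET of its elements (membership _∈_).

Cell : Set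
Cell = ℕ × ℕ

row : Cell → ℕ
row = proj₁

col : Cell → ℕ
col = proj₂

Diagram : Set
Diagram = List Cell

Positive : Diagram → Set
Positive D = ∀ x → x ∈ D → 1 ≤ row x × 1 ≤ col x

_≐_ : Diagram → Diagram → Set
D ≐ E = ∀ x → x ∈ D ⇔ x ∈ E

infix 4 _≐_

-- The Kohnert move, as a (functional) relation:
-- KMove D r D'  means  D' = K(D, r)  (as sets).

RowEmpty : Diagram → ℕ → Set
RowEmpty D r = ∀ c → (r , c) ∉ D

IsRowMax : Diagram → ℕ → ℕ → Set
IsRowMax D r c = (r , c) ∈ D × (∀ c' → (r , c') ∈ D → c' ≤ c)

IsTarget : Diagram → ℕ → ℕ → ℕ → Set
IsTarget D r c r' =
  1 ≤ r' × r' < r × (r' , c) ∉ D ×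
  (∀ r'' → r' < r'' → r'' < r → (r'' , c) ∈ D)

NoTarget : Diagram → ℕ → ℕ → Set
NoTarget D r c = ∀ r' → 1 ≤ r' → r' < r → (r' , c) ∈ D

IsMoved : Diagram → Cell → Cell → Diagram → Set
IsMoved D x y D' = ∀ z → z ∈ D' ⇔ ((z ∈ D × z ≢ x) ⊎ z ≡ y)

KMove : Diagram → ℕ → Diagram → Set
KMove D r D' =
  (RowEmpty D r × D' ≐ D) ⊎
  (Σ ℕ λ c → IsRowMax D r c ×
     ((NoTarget D r c × D' ≐ D) ⊎
      (Σ ℕ λ r' → IsTarget D r c r' × IsMoved D (r , c) (r' , c) D')))

NTMove : Diagram → ℕ → Diagram → Set
NTMove D r D' = KMove D r D' × ¬ (D' ≐ D)

data NTPath : Diagram → ℕ → Diagram → Set where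
  done : ∀ {D E} → E ≐ D → NTPath D 0 E
  step : ∀ {D D₁ E m} (r : ℕ) → NTMove D r D₁ → NTPath D₁ m E →
         NTPath D (suc m) E

Fixed : Diagram → Set
Fixed E = ∀ r → 1 ≤ r → KMove E r E

-- mc(D) = m : m is the minimum length of a sequence of nontrivial
-- Kohnert moves from D to an element of Min(D).
-- (Any diagram reached by moves lies in KD(D), so the endpoint lies in
-- Min(D) iff it is Fixed.)
IsMC : Diagram → ℕ → Set
IsMC D m =
  (Σ Diagram λ E → NTPath D m E × Fixed E) ×
  (∀ m' E → NTPath D m' E → Fixed E → m ≤ m')

-- Statistics of a column (D is assumed duplicate-free for counting).

maxL : List ℕ → ℕ
maxL = foldr _⊔_ 0

colCells : Diagram → ℕ → List Cell
colCells D c = filter (λ x → col x ≟ c) D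

colSize : Diagram → ℕ → ℕ
colSize D c = length (colCells D c)

-- row of the topmost cell of column c (largest row index; Kohnert moves
-- send cells to smaller rows, so row 1 is the bottom)
topRow : Diagram → ℕ → ℕ
topRow D c = maxL (map row (colCells D c))

maxRight : Diagram → ℕ → ℕ
maxRight D c = maxL (map (λ x → if c <ᵇ col x then colSize D (col x) else 0) D)

h : Diagram → ℕ → ℕ
h D c =
  if r ≤ᵇ M then r else (if M ≤ᵇ mc then mc else M)
  where
  r  = topRow D c
  M  = maxRight D c
  mc = colSize D c

-- Write r, m and M for the top row, the size of column c and the largest size of a column right
-- of c; then h = r when r ≤ M and h = m ⊔ M otherwise.
--
-- A nontrivial Kohnert move slides one cell down inside its column, so it lowers
-- the top of that column by at most one and raises no top: the excess Σ (top − h) drops by at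
-- most one per move.  In a diagram fixed by all moves, the rightmost cell of the row of the top
-- of column c has a full column below it, so that top is at most m ⊔ M; as tops also never rise
-- above r, the excess of a fixed diagram is 0.
--
-- Treat the columns from right to left, sliding the top cell of column c down
-- until the top reaches h.  The columns to the right already have tops ≤ M < top, so this cell
-- is the rightmost in its row, and while the top exceeds m there is a gap below it.  In the
-- result a column with M < m is packed into rows 1 … m; any other column has its top at most M,
-- and the rightmost tallest column to its right is packed and occupies every row up to M.  So
-- the rightmost cell of each row lies in a packed column, and no move applies.

module Submission where

open import Defs
open import Data.Nat using (ℕ; _<_; _∸_)
open import Data.Product using (∃; _,_)
open import Data.List using (List; map)
open import Data.Nat.ListAction using (sum)
open import Data.List.Membership.Propositional using (_∈_)
open import Data.List.Relation.Unary.Unique.Propositional using (Unique)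
open import Data.List.Relation.Unary.AllPairs using (AllPairs)
open import Function.Bundles using (_⇔_)

open import Data.Bool using (if_then_else_)
open import Data.Empty using (⊥; ⊥-elim)
open import Data.List using ([]; _∷_; length; filter; applyUpTo)
open import Data.List.Membership.Propositional using (_∉_; find)
open import Data.List.Membership.Propositional.Properties
  using (∈-map⁺; ∈-map⁻; ∈-filter⁺; ∈-filter⁻; ∈-applyUpTo⁺; ∈-applyUpTo⁻)
open import Data.List.Properties
  using (length-map; length-applyUpTo; filter-accept; filter-reject; filter-all; filter-notAll)
open import Data.List.Relation.Binary.Subset.Propositional using (_⊆_)
open import Data.List.Relation.Unary.All using (All; _∷_)
import Data.List.Relation.Unary.All as All
import Data.List.Relation.Unary.All.Properties as All
open import Data.List.Relation.Unary.AllPairs using ([]; _∷_)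
import Data.List.Relation.Unary.AllPairs as AllPairs
open import Data.List.Relation.Unary.Any using (here; there)
import Data.List.Relation.Unary.Any as Any
import Data.List.Relation.Unary.Unique.Propositional.Properties as Unique
open import Data.Nat using (zero; suc; _+_; _≤_; _⊔_; _≤ᵇ_; _<ᵇ_; z≤n; s≤s)
open import Data.Nat.Instances
open import Data.Nat.Properties
open import Data.Product using (_×_; proj₁; proj₂)
import Data.Product as Product
open import Data.Product.Instances
open import Data.Product.Properties using (≡-dec)
open import Data.List.Membership.DecPropositional (≡-dec _≟_ _≟_) using (_∈?_)
open import Data.Sum using (_⊎_; inj₁; inj₂)
import Data.Sum as Sum
open import Function using (_∘_)
open import Function.Bundles using (mk⇔; Equivalence)
import Function.Properties.Equivalence as ⇔
open import Relation.Binary.PropositionalEquality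
  using (_≡_; _≢_; refl; sym; trans; cong; cong₂; subst; ≢-sym)
open import Relation.Binary.Structures using (IsDecEquivalence)
open import Relation.Binary.TypeClasses using () renaming (_≟_ to _≟ⁱ_)
open import Relation.Nullary using (¬_; Dec; yes; no)
open import Relation.Nullary.Decidable using (¬?; _×-dec_)
open import Relation.Nullary.Reflects using (Reflects; ofʸ; ofⁿ)
open import Relation.Unary using (Decidable)

open Equivalence using (to; from)

≤-maxL : ∀ {x xs} → x ∈ xs → x ≤ maxL xs
≤-maxL {xs = y ∷ ys} (here refl)  = m≤m⊔n y (maxL ys)
≤-maxL {xs = y ∷ ys} (there x∈ys) = ≤-trans (≤-maxL x∈ys) (m≤n⊔m y (maxL ys))

maxL-lub : ∀ {k} xs → (∀ {x} → x ∈ xs → x ≤ k) → maxL xs ≤ k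
maxL-lub []       _     = z≤n
maxL-lub (y ∷ ys) bound = ⊔-lub (bound (here refl)) (maxL-lub ys (bound ∘ there))

maxL-sel : ∀ xs → maxL xs ≡ 0 ⊎ maxL xs ∈ xs
maxL-sel []       = inj₁ refl
maxL-sel (y ∷ ys) with ⊔-sel y (maxL ys)
... | inj₁ max≡y  rewrite max≡y  = inj₂ (here refl)
... | inj₂ max≡ys rewrite max≡ys = Sum.map₂ there (maxL-sel ys)

maxL-< : ∀ {k} xs → 0 < k → (∀ {x} → x ∈ xs → x < k) → maxL xs < k
maxL-< xs 0<k bound with maxL-sel xs
... | inj₁ max≡0  = subst (_< _) (sym max≡0) 0<k
... | inj₂ max∈xs = bound max∈xs

argmax : ∀ {A : Set} (f : A → ℕ) {P : A → Set} (P? : Decidable P) {xs x} → x ∈ xs → P x →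
         ∃ λ y → y ∈ xs × P y × (∀ {z} → z ∈ xs → P z → f z ≤ f y)
argmax f P? {xs} {x} x∈xs px with maxL-sel (map f (filter P? xs))
... | inj₁ max≡0 = x , x∈xs , px , λ z∈xs pz →
  ≤-trans (subst (f _ ≤_) max≡0 (≤-maxL (∈-map⁺ f (∈-filter⁺ P? z∈xs pz)))) z≤n
... | inj₂ max∈ with ∈-map⁻ f max∈
...   | y , y∈ , max≡fy with ∈-filter⁻ P? {xs = xs} y∈
...     | y∈xs , py = y , y∈xs , py , λ z∈xs pz →
  subst (f _ ≤_) max≡fy (≤-maxL (∈-map⁺ f (∈-filter⁺ P? z∈xs pz)))

∈⇒length≥1 : ∀ {A : Set} {x : A} {xs} → x ∈ xs → 1 ≤ length xs
∈⇒length≥1 {xs = _ ∷ _} _ = s≤s z≤n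

length≥1⇒∈ : ∀ {A : Set} {xs : List A} → 1 ≤ length xs → ∃ λ x → x ∈ xs
length≥1⇒∈ {xs = x ∷ _} _ = x , here refl

unique-map⁺ : ∀ {A B : Set} {f : A → B} {xs} →
              (∀ {x y} → x ∈ xs → y ∈ xs → f x ≡ f y → x ≡ y) →
              Unique xs → Unique (map f xs)
unique-map⁺ {xs = []}    _   []           = []
unique-map⁺ {xs = _ ∷ _} inj (x∉xs ∷ xs!) =
  All.map⁺ (All.tabulate λ y∈xs fx≡fy → All.lookup x∉xs y∈xs (inj (here refl) (there y∈xs) fx≡fy))
  ∷ unique-map⁺ (λ x∈ y∈ → inj (there x∈) (there y∈)) xs!

sum-map-mono : ∀ {A : Set} {f g : A → ℕ} xs →
               (∀ {x} → x ∈ xs → f x ≤ g x) → sum (map f xs) ≤ sum (map g xs)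
sum-map-mono []       _   = z≤n
sum-map-mono (x ∷ xs) f≤g = +-mono-≤ (f≤g (here refl)) (sum-map-mono xs (f≤g ∘ there))

sum-map-≡0 : ∀ {A : Set} {f : A → ℕ} xs → (∀ x → f x ≡ 0) → sum (map f xs) ≡ 0
sum-map-≡0 []       _   = refl
sum-map-≡0 (x ∷ xs) f≡0 = cong₂ _+_ (f≡0 x) (sum-map-≡0 xs f≡0)

suc[m]∸n≤suc[m∸n] : ∀ m n → suc m ∸ n ≤ suc (m ∸ n)
suc[m]∸n≤suc[m∸n] m       zero    = ≤-refl
suc[m]∸n≤suc[m∸n] zero    (suc n) = subst (_≤ 1) (sym (0∸n≡0 n)) z≤n
suc[m]∸n≤suc[m∸n] (suc m) (suc n) = suc[m]∸n≤suc[m∸n] m n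

if-true : ∀ {P A : Set} {b} {x y : A} → Reflects P b → P → (if b then x else y) ≡ x
if-true (ofʸ _)  _ = refl
if-true (ofⁿ ¬p) p = ⊥-elim (¬p p)

if-false : ∀ {P A : Set} {b} {x y : A} → Reflects P b → ¬ P → (if b then x else y) ≡ y
if-false (ofʸ p) ¬p = ⊥-elim (¬p p)
if-false (ofⁿ _) _  = refl

module _ {A : Set} {{_ : IsDecEquivalence {A = A} _≡_}} where

  private
    remove : A → List A → List A
    remove a = filter (λ x → ¬? (x ≟ⁱ a))

  unique-⊆⇒length≤ : ∀ {xs ys : List A} → Unique xs → xs ⊆ ys → length xs ≤ length ys
  unique-⊆⇒length≤ {[]}     _                   _     = z≤n
  unique-⊆⇒length≤ {x ∷ xs} {ys} (x∉xs ∷ xs!) xs⊆ys = begin-strict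
    length xs            ≤⟨ unique-⊆⇒length≤ xs! xs⊆ys-x ⟩
    length (remove x ys) <⟨ filter-notAll (λ y → ¬? (y ≟ⁱ x)) ys x∈ys ⟩
    length ys            ∎
    where
    open ≤-Reasoning
    x∈ys : Any.Any (λ y → ¬ ¬ (y ≡ x)) ys
    x∈ys = Any.map (λ x≡y y≢x → y≢x (sym x≡y)) (xs⊆ys (here refl))
    xs⊆ys-x : xs ⊆ remove x ys
    xs⊆ys-x y∈xs =
      ∈-filter⁺ (λ y → ¬? (y ≟ⁱ x)) (xs⊆ys (there y∈xs)) (≢-sym (All.lookup x∉xs y∈xs))

  sum-map-≤-suc : ∀ {f g : A → ℕ} {a xs} → Unique xs →
                  (∀ x → x ≢ a → f x ≤ g x) → f a ≤ suc (g a) →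
                  sum (map f xs) ≤ suc (sum (map g xs))
  sum-map-≤-suc {xs = []} _ _ _ = z≤n
  sum-map-≤-suc {f} {g} {a} {x ∷ xs} (x∉xs ∷ xs!) f≤g fa≤1+ga with x ≟ⁱ a
  ... | yes refl = +-mono-≤ fa≤1+ga (sum-map-mono xs λ y∈xs → f≤g _ (≢-sym (All.lookup x∉xs y∈xs)))
  ... | no x≢a   = ≤-trans (+-mono-≤ (f≤g x x≢a) (sum-map-≤-suc xs! f≤g fa≤1+ga))
                           (≤-reflexive (+-suc (g x) (sum (map g xs))))

  _[_↦_] : List A → A → A → List A
  xs [ a ↦ b ] = b ∷ remove a xs

  ∈-↦ : ∀ {xs a b z} → z ∈ xs [ a ↦ b ] ⇔ ((z ∈ xs × z ≢ a) ⊎ z ≡ b)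
  ∈-↦ {xs} {a} = mk⇔ forth back
    where
    forth : ∀ {b z} → z ∈ xs [ a ↦ b ] → (z ∈ xs × z ≢ a) ⊎ z ≡ b
    forth (here z≡b)       = inj₂ z≡b
    forth (there z∈remove) = inj₁ (∈-filter⁻ (λ x → ¬? (x ≟ⁱ a)) z∈remove)
    back : ∀ {b z} → (z ∈ xs × z ≢ a) ⊎ z ≡ b → z ∈ xs [ a ↦ b ]
    back (inj₁ (z∈xs , z≢a)) = there (∈-filter⁺ (λ x → ¬? (x ≟ⁱ a)) z∈xs z≢a)
    back (inj₂ z≡b)          = here z≡b

  length-↦ : ∀ {xs a b} → Unique xs → a ∈ xs → length (xs [ a ↦ b ]) ≡ length xs
  length-↦ {x ∷ xs} (x∉xs ∷ _) (here refl) = cong (suc ∘ length)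
    (trans (filter-reject (λ y → ¬? (y ≟ⁱ x)) λ x≢x → x≢x refl)
           (filter-all (λ y → ¬? (y ≟ⁱ x)) (All.map ≢-sym x∉xs)))
  length-↦ {x ∷ xs} {a} {b} (x∉xs ∷ xs!) (there a∈xs) =
    trans (cong (suc ∘ length) (filter-accept (λ y → ¬? (y ≟ⁱ a)) x≢a))
          (cong suc (length-↦ {b = b} xs! a∈xs))
    where
    x≢a : x ≢ a
    x≢a = All.lookup x∉xs a∈xs

  unique-↦ : ∀ {xs a b} → Unique xs → b ∉ xs → Unique (xs [ a ↦ b ])
  unique-↦ {xs} {a} xs! b∉xs = All.tabulate b∉remove ∷ Unique.filter⁺ (λ x → ¬? (x ≟ⁱ a)) xs!
    where
    b∉remove : ∀ {y} → y ∈ remove a xs → _ ≢ y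
    b∉remove y∈ b≡y =
      b∉xs (subst (_∈ xs) (sym b≡y) (proj₁ (∈-filter⁻ (λ x → ¬? (x ≟ⁱ a)) y∈)))

oneTo : ℕ → List ℕ
oneTo = applyUpTo suc

∈-oneTo⁺ : ∀ {n x} → 1 ≤ x → x ≤ n → x ∈ oneTo n
∈-oneTo⁺ {x = suc i} _ i<n = ∈-applyUpTo⁺ suc i<n

∈-oneTo⁻ : ∀ {n x} → x ∈ oneTo n → 1 ≤ x × x ≤ n
∈-oneTo⁻ x∈ with ∈-applyUpTo⁻ suc x∈
... | _ , i<n , refl = s≤s z≤n , i<n

unique-⊆-oneTo⇒length≤ : ∀ {xs n} → Unique xs → xs ⊆ oneTo n → length xs ≤ n
unique-⊆-oneTo⇒length≤ {n = n} xs! xs⊆ =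
  subst (_ ≤_) (length-applyUpTo suc n) (unique-⊆⇒length≤ xs! xs⊆)

oneTo-⊆⇒≤length : ∀ {xs n} → oneTo n ⊆ xs → n ≤ length xs
oneTo-⊆⇒≤length {n = n} ⊆xs = subst (_≤ _) (length-applyUpTo suc n)
  (unique-⊆⇒length≤ (Unique.applyUpTo⁺₁ suc n λ i<j _ → <⇒≢ (s≤s i<j)) ⊆xs)

∈-colCells⁻ : ∀ {X c x} → x ∈ colCells X c → x ∈ X × col x ≡ c
∈-colCells⁻ {X} {c} = ∈-filter⁻ (λ x → col x ≟ c) {xs = X}

∈-colRows⁺ : ∀ {X ρ c} → (ρ , c) ∈ X → ρ ∈ map row (colCells X c)
∈-colRows⁺ {c = c} cell = ∈-map⁺ row (∈-filter⁺ (λ x → col x ≟ c) cell refl)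

∈-colRows⁻ : ∀ {X ρ c} → ρ ∈ map row (colCells X c) → (ρ , c) ∈ X
∈-colRows⁻ {X} {c = c} ρ∈ with ∈-map⁻ row ρ∈
... | x , x∈ , refl with ∈-colCells⁻ {X} {c} x∈
...   | x∈X , refl = x∈X

≤-topRow : ∀ {X ρ c} → (ρ , c) ∈ X → ρ ≤ topRow X c
≤-topRow cell = ≤-maxL (∈-colRows⁺ cell)

topRow-lub : ∀ {X c k} → (∀ {ρ} → (ρ , c) ∈ X → ρ ≤ k) → topRow X c ≤ k
topRow-lub {X} {c} bound = maxL-lub (map row (colCells X c)) (bound ∘ ∈-colRows⁻)

topRow-< : ∀ {X c k} → 0 < k → (∀ {ρ} → (ρ , c) ∈ X → ρ < k) → topRow X c < k
topRow-< {X} {c} 0<k bound = maxL-< (map row (colCells X c)) 0<k (bound ∘ ∈-colRows⁻)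

topRow-sel : ∀ X c → topRow X c ≡ 0 ⊎ (topRow X c , c) ∈ X
topRow-sel X c = Sum.map₂ ∈-colRows⁻ (maxL-sel (map row (colCells X c)))

topRow-∈ : ∀ {X c} → 1 ≤ topRow X c → (topRow X c , c) ∈ X
topRow-∈ {X} {c} 1≤top with topRow-sel X c
... | inj₁ top≡0 = ⊥-elim (1+n≰n (subst (1 ≤_) top≡0 1≤top))
... | inj₂ top∈X = top∈X

SameColumn : Diagram → Diagram → ℕ → Set
SameColumn X Y c = ∀ {ρ} → (ρ , c) ∈ X ⇔ (ρ , c) ∈ Y

sameColumn⇒topRow≡ : ∀ {X Y c} → SameColumn X Y c → topRow X c ≡ topRow Y c
sameColumn⇒topRow≡ same =
  ≤-antisym (topRow-lub (≤-topRow ∘ to same)) (topRow-lub (≤-topRow ∘ from same))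

Occupied : Diagram → ℕ → Set
Occupied D c = ∃ λ r → (r , c) ∈ D

record ColumnCount (X : Diagram) (c n : ℕ) : Set where
  field
    rows        : List ℕ
    rows-unique : Unique rows
    length-rows : length rows ≡ n
    ∈-rows      : ∀ {ρ} → ρ ∈ rows ⇔ (ρ , c) ∈ X

SameColumnSizes : Diagram → Diagram → Set
SameColumnSizes D X = ∀ c → ColumnCount X c (colSize D c)

columnCount-self : ∀ {D} → Unique D → SameColumnSizes D D
columnCount-self {D} D! c = record
  { rows        = map row (colCells D c)
  ; rows-unique = unique-map⁺ same-row⇒≡ (Unique.filter⁺ (λ x → col x ≟ c) D!)
  ; length-rows = length-map row (colCells D c)
  ; ∈-rows      = mk⇔ ∈-colRows⁻ ∈-colRows⁺
  }
  where
  same-row⇒≡ : ∀ {x y} → x ∈ colCells D c → y ∈ colCells D c → row x ≡ row y → x ≡ y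
  same-row⇒≡ x∈ y∈ row≡ = cong₂ _,_ row≡
    (trans (proj₂ (∈-colCells⁻ {D} {c} x∈)) (sym (proj₂ (∈-colCells⁻ {D} {c} y∈))))

columnCount-resp : ∀ {X Y c n} → ColumnCount X c n → SameColumn X Y c → ColumnCount Y c n
columnCount-resp count same = record
  { rows        = rows
  ; rows-unique = rows-unique
  ; length-rows = length-rows
  ; ∈-rows      = ⇔.trans ∈-rows same
  }
  where open ColumnCount count

columnCount≤topRow : ∀ {X c n} → Positive X → ColumnCount X c n → n ≤ topRow X c
columnCount≤topRow pos count = subst (_≤ _) length-rows
  (unique-⊆-oneTo⇒length≤ rows-unique λ ρ∈ →
    let cell = to ∈-rows ρ∈ in ∈-oneTo⁺ (proj₁ (pos _ cell)) (≤-topRow cell))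
  where open ColumnCount count

noTarget⇒≤columnCount : ∀ {X r c n} → ColumnCount X c n → (r , c) ∈ X → NoTarget X r c → r ≤ n
noTarget⇒≤columnCount {X} {r} {c} count top noTarget = subst (_ ≤_) length-rows
  (oneTo-⊆⇒≤length λ ρ∈ → from ∈-rows (full (∈-oneTo⁻ ρ∈)))
  where
  open ColumnCount count
  full : ∀ {ρ} → 1 ≤ ρ × ρ ≤ r → (ρ , c) ∈ X
  full {ρ} (1≤ρ , ρ≤r) with ρ ≟ r
  ... | yes refl = top
  ... | no ρ≢r   = noTarget ρ 1≤ρ (≤∧≢⇒< ρ≤r ρ≢r)

columnCount-packed : ∀ {X c n} → Positive X → ColumnCount X c n → topRow X c ≤ n →
                     ∀ {ρ} → 1 ≤ ρ → ρ ≤ n → (ρ , c) ∈ X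
columnCount-packed {X} {c} {n} pos count top≤n {ρ} 1≤ρ ρ≤n with (ρ , c) ∈? X
... | yes ρ∈X = ρ∈X
... | no  ρ∉X = ⊥-elim (1+n≰n (subst (λ m → suc m ≤ n) length-rows
                  (unique-⊆-oneTo⇒length≤ (ρ∉rows ∷ rows-unique) bounded)))
  where
  open ColumnCount count
  ρ∉rows : All (ρ ≢_) rows
  ρ∉rows = All.tabulate λ σ∈ ρ≡σ →
    ρ∉X (subst (λ σ → (σ , c) ∈ X) (sym ρ≡σ) (to ∈-rows σ∈))
  bounded : ρ ∷ rows ⊆ oneTo n
  bounded (here refl) = ∈-oneTo⁺ 1≤ρ ρ≤n
  bounded (there σ∈)  = let cell = to ∈-rows σ∈ in
    ∈-oneTo⁺ (proj₁ (pos _ cell)) (≤-trans (≤-topRow cell) top≤n)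

colSize≥1⇒occupied : ∀ {D c} → 1 ≤ colSize D c → Occupied D c
colSize≥1⇒occupied {D} {c} 1≤m with length≥1⇒∈ {xs = colCells D c} 1≤m
... | x , x∈ with ∈-colCells⁻ {D} {c} x∈
...   | x∈D , refl = row x , x∈D

columnCount⇒occupied : ∀ {D X c ρ} → ColumnCount X c (colSize D c) → (ρ , c) ∈ X → Occupied D c
columnCount⇒occupied count cell =
  colSize≥1⇒occupied (subst (1 ≤_) length-rows (∈⇒length≥1 (from ∈-rows cell)))
  where open ColumnCount count

h-cases : ∀ D c → (topRow D c ≤ maxRight D c × h D c ≡ topRow D c)
                ⊎ (maxRight D c < topRow D c × h D c ≡ colSize D c ⊔ maxRight D c)
h-cases D c with topRow D c ≤? maxRight D c
... | yes r≤M = inj₁ (r≤M , if-true (≤ᵇ-reflects-≤ _ _) r≤M)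
... | no  r≰M = inj₂ (≰⇒> r≰M , trans (if-false (≤ᵇ-reflects-≤ _ _) r≰M) larger)
  where
  larger : (if maxRight D c ≤ᵇ colSize D c then colSize D c else maxRight D c)
           ≡ colSize D c ⊔ maxRight D c
  larger with maxRight D c ≤? colSize D c
  ... | yes M≤m = trans (if-true (≤ᵇ-reflects-≤ _ _) M≤m) (sym (m≥n⇒m⊔n≡m M≤m))
  ... | no  M≰m = trans (if-false (≤ᵇ-reflects-≤ _ _) M≰m) (sym (m≤n⇒m⊔n≡n (<⇒≤ (≰⇒> M≰m))))

h-glb : ∀ {D c t} → t ≤ topRow D c → t ≤ colSize D c ⊔ maxRight D c → t ≤ h D c
h-glb {D} {c} t≤r t≤m⊔M with h-cases D c
... | inj₁ (_ , h≡r)   = subst (_ ≤_) (sym h≡r) t≤r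
... | inj₂ (_ , h≡m⊔M) = subst (_ ≤_) (sym h≡m⊔M) t≤m⊔M

h≤colSize⊔maxRight : ∀ D c → h D c ≤ colSize D c ⊔ maxRight D c
h≤colSize⊔maxRight D c with h-cases D c
... | inj₁ (r≤M , h≡r) =
  subst (_≤ colSize D c ⊔ maxRight D c) (sym h≡r) (≤-trans r≤M (m≤n⊔m (colSize D c) _))
... | inj₂ (_ , h≡m⊔M) = ≤-reflexive h≡m⊔M

h≡colSize : ∀ {D c} → maxRight D c < colSize D c → colSize D c ≤ h D c → h D c ≡ colSize D c
h≡colSize {D} {c} M<m m≤h with h-cases D c
... | inj₁ (r≤M , h≡r) = ⊥-elim (<⇒≱ M<m (≤-trans m≤h (subst (_≤ maxRight D c) (sym h≡r) r≤M)))
... | inj₂ (_ , h≡m⊔M) = trans h≡m⊔M (m≥n⇒m⊔n≡m (<⇒≤ M<m))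

rightSize : Diagram → ℕ → Cell → ℕ
rightSize D c x = if c <ᵇ col x then colSize D (col x) else 0

colSize≤maxRight : ∀ {D c c′} → Occupied D c′ → c < c′ → colSize D c′ ≤ maxRight D c
colSize≤maxRight {D} {c} {c′} (_ , cell) c<c′ = subst (_≤ maxRight D c)
  (if-true (<ᵇ-reflects-< c c′) c<c′) (≤-maxL (∈-map⁺ (rightSize D c) cell))

maxRight-antimono : ∀ {D c c′} → c < c′ → maxRight D c′ ≤ maxRight D c
maxRight-antimono {D} {c} {c′} c<c′ = maxL-lub _ bound
  where
  bound : ∀ {s} → s ∈ map (rightSize D c′) D → s ≤ maxRight D c
  bound s∈ with ∈-map⁻ (rightSize D c′) s∈
  ... | x , x∈D , refl with c′ <? col x
  ...   | yes c′<x = subst (_≤ _) (sym (if-true (<ᵇ-reflects-< c′ (col x)) c′<x))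
                       (colSize≤maxRight (row x , x∈D) (<-trans c<c′ c′<x))
  ...   | no  c′≮x = subst (_≤ _) (sym (if-false (<ᵇ-reflects-< c′ (col x)) c′≮x)) z≤n

TallestRight : Diagram → ℕ → Cell → Set
TallestRight D c x = c < col x × colSize D (col x) ≡ maxRight D c

tallestRight? : ∀ D c → Decidable (TallestRight D c)
tallestRight? D c x = (c <? col x) ×-dec (colSize D (col x) ≟ maxRight D c)

maxRight-attained : ∀ D c → 1 ≤ maxRight D c → ∃ λ x → x ∈ D × TallestRight D c x
maxRight-attained D c 1≤M with maxL-sel (map (rightSize D c) D)
... | inj₁ M≡0 = ⊥-elim (1+n≰n (subst (1 ≤_) M≡0 1≤M))
... | inj₂ M∈ with ∈-map⁻ (rightSize D c) M∈
...   | x , x∈D , M≡ with c <? col x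
...     | yes c<x = x , x∈D , c<x , sym (trans M≡ (if-true (<ᵇ-reflects-< c (col x)) c<x))
...     | no  c≮x =
  ⊥-elim (1+n≰n (subst (1 ≤_) (trans M≡ (if-false (<ᵇ-reflects-< c (col x)) c≮x)) 1≤M))

rightmost-tallest : ∀ D c → 1 ≤ maxRight D c →
  ∃ λ c′ → c < c′ × Occupied D c′ × colSize D c′ ≡ maxRight D c × maxRight D c′ < colSize D c′
rightmost-tallest D c 1≤M with maxRight-attained D c 1≤M
... | x , x∈D , x-tallest with argmax col (tallestRight? D c) x∈D x-tallest
...   | y , y∈D , (c<y , y-size) , y-rightmost =
  col y , c<y , (row y , y∈D) , y-size ,
  subst (maxRight D (col y) <_) (sym y-size) (maxL-< _ 1≤M shorter)
  where
  shorter : ∀ {s} → s ∈ map (rightSize D (col y)) D → s < maxRight D c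
  shorter s∈ with ∈-map⁻ (rightSize D (col y)) s∈
  ... | z , z∈D , refl with col y <? col z
  ...   | no  y≮z = subst (_< maxRight D c) (sym (if-false (<ᵇ-reflects-< (col y) (col z)) y≮z)) 1≤M
  ...   | yes y<z = subst (_< maxRight D c) (sym (if-true (<ᵇ-reflects-< (col y) (col z)) y<z))
      (≤∧≢⇒< (colSize≤maxRight (row z , z∈D) c<z)
             λ z-size → <⇒≱ y<z (y-rightmost z∈D (c<z , z-size)))
    where
    c<z : c < col z
    c<z = <-trans c<y y<z

record Slide (X : Diagram) (r c : ℕ) (Y : Diagram) : Set where
  field
    r′     : ℕ
    source : (r , c) ∈ X
    target : IsTarget X r c r′
    moved  : IsMoved X (r , c) (r′ , c) Y

  r′<r : r′ < r
  r′<r = proj₁ (proj₂ target)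

  r′∉X : (r′ , c) ∉ X
  r′∉X = proj₁ (proj₂ (proj₂ target))

  between∈X : ∀ r″ → r′ < r″ → r″ < r → (r″ , c) ∈ X
  between∈X = proj₂ (proj₂ (proj₂ target))

  ∈Y⁻ : ∀ {z} → z ∈ Y → (z ∈ X × z ≢ (r , c)) ⊎ z ≡ (r′ , c)
  ∈Y⁻ = to (moved _)

  ∈Y⁺ : ∀ {z} → z ∈ X → z ≢ (r , c) → z ∈ Y
  ∈Y⁺ z∈X z≢source = from (moved _) (inj₁ (z∈X , z≢source))

  sameColumn : ∀ {c₀} → c₀ ≢ c → SameColumn X Y c₀
  sameColumn c₀≢c = mk⇔ (λ cell → ∈Y⁺ cell (c₀≢c ∘ cong col)) back
    where
    back : ∀ {ρ} → (ρ , _) ∈ Y → (ρ , _) ∈ X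
    back cell with ∈Y⁻ cell
    ... | inj₁ (cell′ , _) = cell′
    ... | inj₂ refl        = ⊥-elim (c₀≢c refl)

  topRow-≤ : ∀ c₀ → topRow Y c₀ ≤ topRow X c₀
  topRow-≤ c₀ = topRow-lub bound
    where
    bound : ∀ {ρ} → (ρ , c₀) ∈ Y → ρ ≤ topRow X c₀
    bound cell with ∈Y⁻ cell
    ... | inj₁ (cell′ , _) = ≤-topRow cell′
    ... | inj₂ refl        = ≤-trans (<⇒≤ r′<r) (≤-topRow source)

  below∈Y : ∀ {q} → r ≡ suc q → (q , c) ∈ Y
  below∈Y {q} refl with q ≟ r′
  ... | yes q≡r′ = from (moved _) (inj₂ (cong (_, c) q≡r′))
  ... | no  q≢r′ = ∈Y⁺ (between∈X q (≤∧≢⇒< (≤-pred r′<r) (≢-sym q≢r′)) ≤-refl)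
                       (λ q,c≡r,c → 1+n≢n (sym (cong row q,c≡r,c)))

  topRow-≤suc : topRow X c ≤ suc (topRow Y c)
  topRow-≤suc = topRow-lub bound
    where
    bound : ∀ {ρ} → (ρ , c) ∈ X → ρ ≤ suc (topRow Y c)
    bound {ρ} cell with ρ ≟ r
    ... | no ρ≢r = m≤n⇒m≤1+n (≤-topRow (∈Y⁺ cell (ρ≢r ∘ cong row)))
    ... | yes refl with r′<r
    ...   | s≤s _ = s≤s (≤-topRow (below∈Y refl))

  topRow-top : topRow X c ≡ r → suc (topRow Y c) ≡ r
  topRow-top top≡r = ≤-antisym (topRow-< (≤-<-trans z≤n r′<r) below-r)
                               (subst (_≤ suc (topRow Y c)) top≡r topRow-≤suc)
    where
    below-r : ∀ {ρ} → (ρ , c) ∈ Y → ρ < r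
    below-r cell with ∈Y⁻ cell
    ... | inj₁ (cell′ , ≢source) =
      ≤∧≢⇒< (subst (_ ≤_) top≡r (≤-topRow cell′)) (≢source ∘ cong (_, c))
    ... | inj₂ refl = r′<r

  columnCount : ∀ {c₀ n} → ColumnCount X c₀ n → ColumnCount Y c₀ n
  columnCount {c₀} count with c₀ ≟ c
  ... | no  c₀≢c = columnCount-resp count (sameColumn c₀≢c)
  ... | yes refl = record
    { rows        = rows [ r ↦ r′ ]
    ; rows-unique = unique-↦ rows-unique (r′∉X ∘ to ∈-rows)
    ; length-rows = trans (length-↦ {b = r′} rows-unique (from ∈-rows source)) length-rows
    ; ∈-rows      = ⇔.trans ∈-↦ (⇔.trans inColumn (⇔.sym (moved _)))
    }
    where
    open ColumnCount count
    inColumn : ∀ {ρ} → ((ρ ∈ rows × ρ ≢ r) ⊎ ρ ≡ r′)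
                     ⇔ (((ρ , c) ∈ X × (ρ , c) ≢ (r , c)) ⊎ (ρ , c) ≡ (r′ , c))
    inColumn = mk⇔ (Sum.map (Product.map (to ∈-rows) (λ ρ≢r → ρ≢r ∘ cong row)) (cong (_, c)))
                   (Sum.map (Product.map (from ∈-rows) (λ ρc≢rc → ρc≢rc ∘ cong (_, c))) (cong row))

  positive : Positive X → Positive Y
  positive pos z z∈Y with ∈Y⁻ z∈Y
  ... | inj₁ (z∈X , _) = pos z z∈X
  ... | inj₂ refl      = proj₁ target , proj₂ (pos _ source)

  nontrivial : ¬ (Y ≐ X)
  nontrivial Y≐X with ∈Y⁻ (from (Y≐X _) source)
  ... | inj₁ (_ , source≢source) = source≢source refl
  ... | inj₂ source≡target       = <⇒≢ r′<r (sym (cong row source≡target))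

  ntMove : IsRowMax X r c → NTMove X r Y
  ntMove rowMax = inj₂ (c , rowMax , inj₂ (r′ , target , moved)) , nontrivial

ntMove⇒slide : ∀ {X r Y} → NTMove X r Y → ∃ λ c → Slide X r c Y
ntMove⇒slide (inj₁ (_ , Y≐X) , Y≉X)                = ⊥-elim (Y≉X Y≐X)
ntMove⇒slide (inj₂ (_ , _ , inj₁ (_ , Y≐X)) , Y≉X) = ⊥-elim (Y≉X Y≐X)
ntMove⇒slide (inj₂ (c , (source , _) , inj₂ (r′ , target , moved)) , _) =
  c , record { r′ = r′ ; source = source ; target = target ; moved = moved }

target? : ∀ X r c → (∃ λ r′ → IsTarget X r c r′) ⊎ NoTarget X r c
target? X zero    c = inj₂ λ _ _ ()
target? X (suc t) c = scan t ≤-refl λ r″ t<r″ r″≤t → ⊥-elim (<⇒≱ t<r″ (≤-pred r″≤t))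
  where
  scan : ∀ n → n ≤ t → (∀ r″ → n < r″ → r″ < suc t → (r″ , c) ∈ X) →
         (∃ λ r′ → IsTarget X (suc t) c r′) ⊎ NoTarget X (suc t) c
  scan zero    _   above = inj₂ above
  scan (suc n) n<t above with (suc n , c) ∈? X
  ... | no  n∉X = inj₁ (suc n , s≤s z≤n , s≤s n<t , n∉X , above)
  ... | yes n∈X = scan n (<⇒≤ n<t) above′
    where
    above′ : ∀ r″ → n < r″ → r″ < suc t → (r″ , c) ∈ X
    above′ r″ n<r″ r″<r with r″ ≟ suc n
    ... | yes refl = n∈X
    ... | no  r″≢n = above r″ (≤∧≢⇒< n<r″ (≢-sym r″≢n)) r″<r

rowMax? : ∀ X r → RowEmpty X r ⊎ ∃ (IsRowMax X r)
rowMax? X r with Any.any? (λ x → row x ≟ r) X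
... | no  noneInRow = inj₁ λ _ cell → noneInRow (Any.map (λ r,c≡x → cong row (sym r,c≡x)) cell)
... | yes someInRow with find someInRow
...   | x , x∈X , refl with argmax col (λ y → row y ≟ row x) x∈X refl
...     | y , y∈X , row≡ , rightmost =
  inj₂ (col y , subst (λ ρ → (ρ , col y) ∈ X) row≡ y∈X , λ _ cell → rightmost cell refl)

fixed⇒noTarget : ∀ {E r c} → Fixed E → 1 ≤ r → (r , c) ∈ E →
                 ∃ λ c′ → IsRowMax E r c′ × NoTarget E r c′
fixed⇒noTarget fixed 1≤r cell with fixed _ 1≤r
... | inj₁ (empty , _)                         = ⊥-elim (empty _ cell)
... | inj₂ (c′ , rowMax , inj₁ (noTarget , _)) = c′ , rowMax , noTarget
... | inj₂ (c′ , (source , _) , inj₂ (r′ , target , moved)) =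
  ⊥-elim (Slide.nontrivial slide λ _ → ⇔.refl)
  where
  slide : Slide _ _ c′ _
  slide = record { r′ = r′ ; source = source ; target = target ; moved = moved }

noTarget⇒fixed : ∀ {E} → (∀ {r c} → 1 ≤ r → IsRowMax E r c → NoTarget E r c) → Fixed E
noTarget⇒fixed {E} noTarget r 1≤r with rowMax? E r
... | inj₁ empty        = inj₁ (empty , λ _ → ⇔.refl)
... | inj₂ (c , rowMax) = inj₂ (c , rowMax , inj₁ (noTarget 1≤r rowMax , λ _ → ⇔.refl))

fixed⇒topRow≤ : ∀ {D E} → Fixed E → SameColumnSizes D E →
                ∀ c → topRow E c ≤ colSize D c ⊔ maxRight D c
fixed⇒topRow≤ {D} {E} fixed sizes c with topRow E c | topRow-sel E c
... | zero  | _        = z≤n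
... | suc _ | inj₁ ()
... | suc t | inj₂ top with fixed⇒noTarget fixed (s≤s z≤n) top
...   | c′ , (cell , rightmost) , noTarget =
  ≤-trans (noTarget⇒≤columnCount (sizes c′) cell noTarget) (size≤ (m≤n⇒m<n∨m≡n (rightmost c top)))
  where
  size≤ : c < c′ ⊎ c ≡ c′ → colSize D c′ ≤ colSize D c ⊔ maxRight D c
  size≤ (inj₁ c<c′) =
    ≤-trans (colSize≤maxRight (columnCount⇒occupied {D} (sizes c′) cell) c<c′) (m≤n⊔m _ _)
  size≤ (inj₂ refl) = m≤m⊔n _ _

excess : Diagram → Diagram → List ℕ → ℕ
excess D X cs = sum (map (λ c → topRow X c ∸ h D c) cs)

excess-slide : ∀ {D X Y r c cs} → Unique cs → Slide X r c Y → excess D X cs ≤ suc (excess D Y cs)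
excess-slide {D} {X} {Y} {c = c} cs! s =
  sum-map-≤-suc {f = λ c₀ → topRow X c₀ ∸ h D c₀} {g = λ c₀ → topRow Y c₀ ∸ h D c₀}
                cs! elsewhere at-c
  where
  open Slide s
  elsewhere : ∀ c₀ → c₀ ≢ c → topRow X c₀ ∸ h D c₀ ≤ topRow Y c₀ ∸ h D c₀
  elsewhere c₀ c₀≢c = ≤-reflexive (cong (_∸ h D c₀) (sameColumn⇒topRow≡ (sameColumn c₀≢c)))
  at-c : topRow X c ∸ h D c ≤ suc (topRow Y c ∸ h D c)
  at-c = ≤-trans (∸-monoˡ-≤ (h D c) topRow-≤suc) (suc[m]∸n≤suc[m∸n] (topRow Y c) (h D c))

excess-≤-length : ∀ {D X E m cs} → Unique cs → NTPath X m E → Fixed E → SameColumnSizes D X →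
                  (∀ c → topRow X c ≤ topRow D c) → excess D X cs ≤ m
excess-≤-length {D} {X} {cs = cs} _ (done E≐X) fixed sizes below =
  ≤-reflexive (sum-map-≡0 cs λ c → m≤n⇒m∸n≡0 (h-glb {D} (below c) (topRow≤ c)))
  where
  topRow≤ : ∀ c → topRow X c ≤ colSize D c ⊔ maxRight D c
  topRow≤ c = subst (_≤ _) (sameColumn⇒topRow≡ (E≐X _))
    (fixed⇒topRow≤ {D} fixed (λ c₀ → columnCount-resp (sizes c₀) (⇔.sym (E≐X _))) c)
excess-≤-length {D} cs! (step _ move path) fixed sizes below with ntMove⇒slide move
... | _ , s = ≤-trans (excess-slide {D} cs! s)
  (s≤s (excess-≤-length {D} cs! path fixed (columnCount ∘ sizes) λ c → ≤-trans (topRow-≤ c) (below c)))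
  where open Slide s

infixr 5 _◅_ _◅◅_

data Moves : Diagram → ℕ → Diagram → Set where
  ε   : ∀ {X} → Moves X 0 X
  _◅_ : ∀ {X Y Z r n} → NTMove X r Y → Moves Y n Z → Moves X (suc n) Z

_◅◅_ : ∀ {X Y Z m n} → Moves X m Y → Moves Y n Z → Moves X (m + n) Z
ε              ◅◅ moves′ = moves′
(move ◅ moves) ◅◅ moves′ = move ◅ (moves ◅◅ moves′)

moves⇒NTPath : ∀ {X n Y} → Moves X n Y → NTPath X n Y
moves⇒NTPath ε              = done λ _ → ⇔.refl
moves⇒NTPath (move ◅ moves) = step _ move (moves⇒NTPath moves)

slideTopCell : ∀ {D X c t} → SameColumnSizes D X → colSize D c < t →
               (∀ {ρ c′} → (ρ , c′) ∈ X → c < c′ → ρ < t) → topRow X c ≡ t →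
               ∃ λ Y → NTMove X t Y × Slide X t c Y
slideTopCell {D} {X} {c} {t} sizes m<t rightLow top≡t = slide (target? X t c)
  where
  source : (t , c) ∈ X
  source = subst (λ r → (r , c) ∈ X) top≡t (topRow-∈ (subst (1 ≤_) (sym top≡t) (≤-<-trans z≤n m<t)))
  rowMax : IsRowMax X t c
  rowMax = source , λ c′ cell → ≮⇒≥ λ c<c′ → <-irrefl refl (rightLow cell c<c′)
  slide : (∃ λ r′ → IsTarget X t c r′) ⊎ NoTarget X t c → ∃ λ Y → NTMove X t Y × Slide X t c Y
  slide (inj₂ noTarget)      = ⊥-elim (<⇒≱ m<t (noTarget⇒≤columnCount (sizes c) source noTarget))
  slide (inj₁ (r′ , target)) = _ , Slide.ntMove s rowMax , s
    where
    s : Slide X t c (X [ (t , c) ↦ (r′ , c) ])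
    s = record { r′ = r′ ; source = source ; target = target ; moved = λ _ → ∈-↦ }

record ColumnLowering (D X : Diagram) (c k g : ℕ) : Set where
  field
    Y        : Diagram
    moves    : Moves X k Y
    positive : Positive Y
    sizes    : SameColumnSizes D Y
    topRow≡  : topRow Y c ≡ g
    others   : ∀ {c₀} → c₀ ≢ c → SameColumn X Y c₀

noLowering : ∀ {D X c g} → Positive X → SameColumnSizes D X → topRow X c ≡ g →
             ColumnLowering D X c 0 g
noLowering pos sizes top≡g = record
  { Y        = _
  ; moves    = ε
  ; positive = pos
  ; sizes    = sizes
  ; topRow≡  = top≡g
  ; others   = λ _ → ⇔.refl
  }

lowerColumn : ∀ {D X c g} k → Positive X → SameColumnSizes D X → colSize D c ≤ g →
              (∀ {ρ c′} → (ρ , c′) ∈ X → c < c′ → ρ ≤ g) → topRow X c ≡ k + g →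
              ColumnLowering D X c k g
lowerColumn zero pos sizes _ _ top≡g = noLowering pos sizes top≡g
lowerColumn {D} {X} {c} {g} (suc k) pos sizes m≤g rightLow top≡
  with slideTopCell {D} sizes (s≤s (≤-trans m≤g (m≤n+m g k)))
                    (λ cell c<c′ → s≤s (≤-trans (rightLow cell c<c′) (m≤n+m g k))) top≡
... | Y , move , s = record
  { Y        = rest.Y
  ; moves    = move ◅ rest.moves
  ; positive = rest.positive
  ; sizes    = rest.sizes
  ; topRow≡  = rest.topRow≡
  ; others   = λ c₀≢c → ⇔.trans (Slide.sameColumn s c₀≢c) (rest.others c₀≢c)
  }
  where
  rightLowY : ∀ {ρ c′} → (ρ , c′) ∈ Y → c < c′ → ρ ≤ g
  rightLowY cell c<c′ = rightLow (from (Slide.sameColumn s (≢-sym (<⇒≢ c<c′))) cell) c<c′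
  rest : ColumnLowering D Y c k g
  rest = lowerColumn k (Slide.positive s pos) (Slide.columnCount s ∘ sizes) m≤g rightLowY
                     (suc-injective (Slide.topRow-top s top≡))
  module rest = ColumnLowering rest

lowerColumnToH : ∀ {D X c} → Positive X → SameColumnSizes D X → topRow X c ≡ topRow D c →
                 (∀ {ρ c′} → (ρ , c′) ∈ X → c < c′ → ρ ≤ maxRight D c) →
                 ColumnLowering D X c (topRow D c ∸ h D c) (h D c)
lowerColumnToH {D} {X} {c} pos sizes top≡ rightLow with h-cases D c
... | inj₁ (_ , h≡r) rewrite h≡r | n∸n≡0 (topRow D c) = noLowering pos sizes top≡
... | inj₂ (M<r , h≡m⊔M) rewrite h≡m⊔M =
  lowerColumn {D} (topRow D c ∸ (colSize D c ⊔ maxRight D c)) pos sizes (m≤m⊔n _ _)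
              (λ cell c<c′ → ≤-trans (rightLow cell c<c′) (m≤n⊔m (colSize D c) _))
              (trans top≡ (sym (m∸n+n≡m m⊔M≤r)))
  where
  m⊔M≤r : colSize D c ⊔ maxRight D c ≤ topRow D c
  m⊔M≤r = ⊔-lub (subst (_ ≤_) top≡ (columnCount≤topRow pos (sizes c))) (<⇒≤ M<r)

FinalSegment : Diagram → List ℕ → Set
FinalSegment D cs = ∀ {c} → Occupied D c → c ∈ cs ⊎ All (c <_) cs

finalSegment-tail : ∀ {D c cs} → All (c <_) cs → FinalSegment D (c ∷ cs) → FinalSegment D cs
finalSegment-tail c<cs final occ with final occ
... | inj₁ (here refl)   = inj₂ c<cs
... | inj₁ (there c₀∈cs) = inj₁ c₀∈cs
... | inj₂ (_ ∷ c₀<cs)   = inj₂ c₀<cs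

record Flattening (D : Diagram) (cs : List ℕ) : Set where
  field
    E        : Diagram
    moves    : Moves D (excess D D cs) E
    positive : Positive E
    sizes    : SameColumnSizes D E
    settled  : ∀ {c} → c ∈ cs → topRow E c ≡ h D c
    others   : ∀ {c} → c ∉ cs → SameColumn D E c

flatten-∷ : ∀ {D c cs} → All (c <_) cs → FinalSegment D (c ∷ cs) →
            Flattening D cs → Flattening D (c ∷ cs)
flatten-∷ {D} {c} {cs} c<cs final flat = record
  { E        = low.Y
  ; moves    = subst (λ n → Moves D n low.Y) (+-comm (excess D D cs) _) (moves ◅◅ low.moves)
  ; positive = low.positive
  ; sizes    = low.sizes
  ; settled  = settled′
  ; others   = λ c₀∉ → ⇔.trans (others (c₀∉ ∘ there)) (low.others (c₀∉ ∘ here))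
  }
  where
  open Flattening flat
  c∉cs : c ∉ cs
  c∉cs c∈cs = <-irrefl refl (All.lookup c<cs c∈cs)
  rightLow : ∀ {ρ c′} → (ρ , c′) ∈ E → c < c′ → ρ ≤ maxRight D c
  rightLow {ρ} {c′} cell c<c′ = below (final occ)
    where
    occ : Occupied D c′
    occ = columnCount⇒occupied {D} (sizes c′) cell
    below : c′ ∈ c ∷ cs ⊎ All (c′ <_) (c ∷ cs) → ρ ≤ maxRight D c
    below (inj₁ (here refl))   = ⊥-elim (<-irrefl refl c<c′)
    below (inj₂ (c′<c ∷ _))    = ⊥-elim (<-asym c<c′ c′<c)
    below (inj₁ (there c′∈cs)) = begin
      ρ                            ≤⟨ ≤-topRow cell ⟩
      topRow E c′                  ≡⟨ settled c′∈cs ⟩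
      h D c′                       ≤⟨ h≤colSize⊔maxRight D c′ ⟩
      colSize D c′ ⊔ maxRight D c′ ≤⟨ ⊔-lub (colSize≤maxRight occ c<c′)
                                             (maxRight-antimono {D} c<c′) ⟩
      maxRight D c                 ∎
      where open ≤-Reasoning
  low : ColumnLowering D E c (topRow D c ∸ h D c) (h D c)
  low = lowerColumnToH positive sizes (sym (sameColumn⇒topRow≡ (others c∉cs))) rightLow
  module low = ColumnLowering low
  settled′ : ∀ {c₀} → c₀ ∈ c ∷ cs → topRow low.Y c₀ ≡ h D c₀
  settled′ (here refl)   = low.topRow≡
  settled′ (there c₀∈cs) = trans (sym (sameColumn⇒topRow≡ (low.others c₀≢c))) (settled c₀∈cs)
    where
    c₀≢c : _ ≢ c
    c₀≢c c₀≡c = c∉cs (subst (_∈ cs) c₀≡c c₀∈cs)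

flatten : ∀ {D} → Positive D → Unique D → ∀ cs → AllPairs _<_ cs → FinalSegment D cs →
          Flattening D cs
flatten pos D! [] _ _ = record
  { E        = _
  ; moves    = ε
  ; positive = pos
  ; sizes    = columnCount-self D!
  ; settled  = λ ()
  ; others   = λ _ → ⇔.refl
  }
flatten pos D! (c ∷ cs) (c<cs ∷ sorted) final =
  flatten-∷ c<cs final (flatten pos D! cs sorted (finalSegment-tail c<cs final))

tall-settled : ∀ {D E c} → Positive E → SameColumnSizes D E → topRow E c ≡ h D c →
               maxRight D c < colSize D c → topRow E c ≡ colSize D c
tall-settled {D} {c = c} pos sizes top≡h M<m =
  trans top≡h (h≡colSize {D} M<m (subst (_ ≤_) top≡h (columnCount≤topRow pos (sizes c))))

settled⇒fixed : ∀ {D E} → Positive E → SameColumnSizes D E →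
                (∀ {c} → Occupied D c → topRow E c ≡ h D c) → Fixed E
settled⇒fixed {D} {E} pos sizes settled = noTarget⇒fixed noTarget
  where
  packed : ∀ {c} → topRow E c ≡ colSize D c → ∀ {ρ} → 1 ≤ ρ → ρ ≤ colSize D c → (ρ , c) ∈ E
  packed {c} top≡m = columnCount-packed pos (sizes c) (≤-reflexive top≡m)
  noTarget : ∀ {r c} → 1 ≤ r → IsRowMax E r c → NoTarget E r c
  noTarget {r} {c} 1≤r (cell , rightmost) = byHeight (maxRight D c <? colSize D c)
    where
    top≡h : topRow E c ≡ h D c
    top≡h = settled (columnCount⇒occupied {D} (sizes c) cell)
    occupiedFurtherRight : r ≤ maxRight D c → ⊥
    occupiedFurtherRight r≤M with rightmost-tallest D c (≤-trans 1≤r r≤M)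
    ... | c′ , c<c′ , occ′ , m′≡M , M′<m′ = <⇒≱ c<c′ (rightmost c′
      (packed (tall-settled {D} pos sizes (settled occ′) M′<m′) 1≤r (subst (r ≤_) (sym m′≡M) r≤M)))
    byHeight : Dec (maxRight D c < colSize D c) → NoTarget E r c
    byHeight (yes M<m) ρ 1≤ρ ρ<r =
      packed top≡m 1≤ρ (≤-trans (<⇒≤ ρ<r) (subst (r ≤_) top≡m (≤-topRow cell)))
      where top≡m = tall-settled {D} pos sizes top≡h M<m
    byHeight (no M≮m) = ⊥-elim (occupiedFurtherRight (begin
      r                           ≤⟨ ≤-topRow cell ⟩
      topRow E c                  ≡⟨ top≡h ⟩
      h D c                       ≤⟨ h≤colSize⊔maxRight D c ⟩
      colSize D c ⊔ maxRight D c  ≡⟨ m≤n⇒m⊔n≡n (≮⇒≥ M≮m) ⟩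
      maxRight D c                ∎))
      where open ≤-Reasoning

theorem4p1 : (D : Diagram) → Positive D → Unique D →
    (cs : List ℕ) → AllPairs _<_ cs →
    (∀ c → c ∈ cs ⇔ ∃ λ r → (r , c) ∈ D) →
    IsMC D (sum (map (λ c → topRow D c ∸ h D c) cs))
theorem4p1 D pos D! cs sorted columns =
  (E , moves⇒NTPath moves , settled⇒fixed {D} positive sizes (settled ∘ occupied⇒∈cs)) ,
  λ _ _ path fixed →
    excess-≤-length {D} (AllPairs.map <⇒≢ sorted) path fixed (columnCount-self D!) λ _ → ≤-refl
  where
  occupied⇒∈cs : ∀ {c} → Occupied D c → c ∈ cs
  occupied⇒∈cs = from (columns _)
  open Flattening (flatten pos D! cs sorted (inj₁ ∘ occupied⇒∈cs))
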